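{- Let $\mathcal H=(\{H_i\}_{i\in[k]};\mathcal Q_1,\dots,\mathcal Q_n)$ be a finite multi-sorted relational structure in which each domain $H_i$ occurs among $\mathcal Q_1,\dots,\mathcal Q_n$ as a unary relation, let $b(\mathcal H)$ be its binarization, and let $p$ be a prime. Then (1) $\mathcal H$ has a Mal'tsev polymorphism if and only if $b(\mathcal H)$ has a Mal'tsev polymorphism; (2) $\mathcal H$ is $p$-rigid if and only if $b(\mathcal H)$ is $p$-rigid; (3) if $\mathcal H$ is strongly $p$-rectangular, then so is $b(\mathcal H)$.
   Context: A multi-sorted structure has base set a family of disjoint finite sets; each relation has a type $(i_1,\dots,i_\ell)$ and is a subset of $H_{i_1}\times\dots\times H_{i_\ell}$. The binarization $b(\mathcal H)$ is the multi-sorted structure whose domains are $\mathcal Q_1,\dots,\mathcal Q_n$ viewed as sets of tuples, and which contains, for all $i\le j$ in $[n]$, $s\in[\mathrm{ar}(\mathcal Q_i)]$, $t\in[\mathrm{ar}(\mathcal Q_j)]$, the binary relation $\mathcal R^{ij}_{st}=\{(\mathbf a,\mathbf b)\mid\mathbf a\in\mathcal Q_i,\mathbf b\in\mathcal Q_j,\mathbf a[s]=\mathbf b[t]\}$. A Mal'tsev polymorphism of a multi-sorted structure is a family $f=\{f_i:D_i^3\to D_i\}$ over its domains $D_i$ with $f_i(a,a,b)=f_i(b,a,a)=b$ for all $a,b\in D_i$, such that for each relation of type $(i_1,\dots,i_\ell)$ and any three of its tuples, applying $f_{i_j}$ in coordinate $j$ yields a tuple of the relation. An automorphism $\pi=\{\pi_i\}$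 has order $p$ if each $\pi_i$ is the identity or has order $p$ and at least one is not the identity; the structure is $p$-rigid if it has no automorphism of order $p$. The $p$-modular quantifier $\exists^{\equiv p}\mathbf y\,\Phi(\mathbf x,\mathbf y)$ holds for $\mathbf x=\mathbf a$ iff the number of $\mathbf b$ (ranging over the appropriate typed domains) with $\Phi(\mathbf a,\mathbf b)$ true is not divisible by $p$. A relation is $p$-mpp-definable in a structure if defined by a formula $\exists^{\equiv p}Y_1\cdots\exists^{\equiv p}Y_m\Phi$, where $\Phi$ is a conjunction of atomic formulas using the structure's relations and equality on each domain, with typed variables consistent with relation types. A relation $\mathcal R$ of arity $n\ge2$ is rectangular if for every nonempty $I\subsetneq[n]$, viewed as a binary relation between $\mathrm{pr}_I\mathcal R$ and $\mathrm{pr}_{[n]\setminus I}\mathcal R$, $(a,c),(a,d),(b,c)\in\mathcal R$ imply $(b,d)\in\mathcal R$. A structure is strongly $p$-rectangular if every $p$-mpp-definable relation in it of arity at least 2 is rectangular. -}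

module Defs where

open import Data.Nat as ℕ using (ℕ; zero; suc; _≤_; _<_)
open import Data.Nat.Divisibility using (_∣?_)
import Data.Bool
open import Data.Bool using (Bool; true; false; T; not; if_then_else_)
open import Data.Bool.Properties using (T-irrelevant)
open import Data.Fin as Fin using (Fin; zero; suc)
open import Data.Fin.Subset using (Subset; ∁; Nonempty) renaming (_∈_ to _∈ₛ_)
open import Data.List as List using (List; []; _∷_; _++_; length; cartesianProductWith)
open import Data.List.Relation.Unary.All as All using (All; []; _∷_)
open import Data.List.Relation.Unary.All.Properties as AllP using ()
open import Data.List.Relation.Unary.Any using (here; there)
open import Data.List.Relation.Unary.AllPairs using ([]; _∷_)
open import Data.List.Membership.Propositional using (_∈_)
open import Data.List.Membership.Propositional.Properties using (∈-cartesianProductWith⁺)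
open import Data.List.Relation.Unary.Unique.Propositional using (Unique)
open import Data.List.Relation.Unary.Unique.Propositional.Properties using (cartesianProductWith⁺)
open import Data.Product using (Σ; ∃; _×_; _,_; proj₁; proj₂)
open import Data.Sum using (_⊎_)
open import Data.Empty using (⊥-elim)
open import Data.Unit using (tt)
open import Function.Definitions using (Bijective)
open import Relation.Nullary using (¬_; Dec; yes; no; ⌊_⌋)
open import Relation.Nullary.Decidable using (T?)
open import Relation.Binary.Definitions using (DecidableEquality)
open import Relation.Binary.PropositionalEquality using (_≡_; _≢_; refl; cong)

-- Sorts are indexed by Fin k; the domain of sort i is the type D i,
-- which is finite: 'enum i' lists each element exactly once.
-- (Disjointness of the domains is automatic: they are distinct types.)
-- Relations are indexed by a type RI; relation r has type 'typ r'
-- (a list of sorts (i₁,…,i_ℓ), the arity is its length) and is the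
-- (decidable) subset R r of H_{i₁} × ⋯ × H_{i_ℓ}, whose tuples are
-- represented as All D (typ r).

record MS (RI : Set) : Set₁ where
  field
    k             : ℕ
    D             : Fin k → Set
    decEq         : ∀ i → DecidableEquality (D i)
    enum          : ∀ i → List (D i)
    enum-complete : ∀ i (x : D i) → x ∈ enum i
    enum-unique   : ∀ i → Unique (enum i)
    typ           : RI → List (Fin k)
    R             : (r : RI) → All D (typ r) → Bool

module Tuples {k : ℕ} (D : Fin k → Set) where

  at : ∀ {Γ : List (Fin k)} → All D Γ → (s : Fin (length Γ)) → D (List.lookup Γ s)
  at (x ∷ a) zero    = x
  at (x ∷ a) (suc s) = at a s

  map3 : (∀ i → D i → D i → D i → D i) →
         ∀ {Γ} → All D Γ → All D Γ → All D Γ → All D Γ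
  map3 f []       []       []       = []
  map3 f (x ∷ a) (y ∷ b) (z ∷ c) = f _ x y z ∷ map3 f a b c

  map1 : (∀ i → D i → D i) → ∀ {Γ} → All D Γ → All D Γ
  map1 π []      = []
  map1 π (x ∷ a) = π _ x ∷ map1 π a

  module _ (decEq : ∀ i → DecidableEquality (D i)) where

    decEqAll : ∀ {Γ} → DecidableEquality (All D Γ)
    decEqAll [] [] = yes refl
    decEqAll (x ∷ a) (y ∷ b) with decEq _ x y | decEqAll a b
    ... | yes refl | yes refl = yes refl
    ... | no ne    | _        = no λ { refl → ne refl }
    ... | yes _    | no ne    = no λ { refl → ne refl }

    -- equality of elements of possibly different sorts (false if the
    -- sorts differ, the domains being disjoint)
    sameElem : ∀ {i j} → D i → D j → Bool
    sameElem {i} {j} x y with i Fin.≟ j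
    ... | yes refl = ⌊ decEq i x y ⌋
    ... | no _     = false

  module _ (enum : ∀ i → List (D i)) where

    enumAll : (Γ : List (Fin k)) → List (All D Γ)
    enumAll []      = [] ∷ []
    enumAll (i ∷ Γ) = cartesianProductWith _∷_ (enum i) (enumAll Γ)

    enumAll-complete : (∀ i (x : D i) → x ∈ enum i) →
                       ∀ Γ (a : All D Γ) → a ∈ enumAll Γ
    enumAll-complete c []      []      = here refl
    enumAll-complete c (i ∷ Γ) (x ∷ a) =
      ∈-cartesianProductWith⁺ _∷_ (c i x) (enumAll-complete c Γ a)

    enumAll-unique : (∀ i → Unique (enum i)) → ∀ Γ → Unique (enumAll Γ)
    enumAll-unique u []      = [] ∷ []
    enumAll-unique u (i ∷ Γ) =
      cartesianProductWith⁺ _∷_ (λ { refl → refl , refl }) (u i) (enumAll-unique u Γ)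

module Select {A : Set} (P : A → Bool) where

  sel : List A → List (Σ A (λ a → T (P a)))
  sel []       = []
  sel (x ∷ xs) with T? (P x)
  ... | yes q = (x , q) ∷ sel xs
  ... | no _  = sel xs

  sel-complete : ∀ {xs} x (px : T (P x)) → x ∈ xs → (x , px) ∈ sel xs
  sel-complete {y ∷ xs} x px (here refl) with T? (P y)
  ... | yes q = here (cong (y ,_) (T-irrelevant px q))
  ... | no nq = ⊥-elim (nq px)
  sel-complete {y ∷ xs} x px (there m) with T? (P y)
  ... | yes q = there (sel-complete x px m)
  ... | no _  = sel-complete x px m

  sel-sound : ∀ {xs} z → z ∈ sel xs → proj₁ z ∈ xs
  sel-sound {y ∷ xs} z m with T? (P y)
  sel-sound {y ∷ xs} z (here refl) | yes q = here refl
  sel-sound {y ∷ xs} z (there m)   | yes q = there (sel-sound z m)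
  sel-sound {y ∷ xs} z m           | no _  = there (sel-sound z m)

  sel-unique : ∀ {xs} → Unique xs → Unique (sel xs)
  sel-unique {[]}     []        = []
  sel-unique {y ∷ xs} (d ∷ u) with T? (P y)
  ... | yes q = All.tabulate (λ {z} m e → All.lookup d (sel-sound z m) (cong proj₁ e))
                ∷ sel-unique u
  ... | no _  = sel-unique u

-- Binarization b(H) of a structure H with relations Q_1,…,Q_n.
-- Sorts of b(H): Fin n; domain of sort i: the tuples of Q_i.
-- Relations of b(H): R^{ij}_{st} for i ≤ j, s ∈ [ar Q_i], t ∈ [ar Q_j].

module _ {n : ℕ} (H : MS (Fin n)) where
  open MS H
  open Tuples D

  Qdom : Fin n → Set
  Qdom i = Σ (All D (typ i)) (λ a → T (R i a))

  BinIdx : Set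
  BinIdx = Σ (Fin n) λ i → Σ (Fin n) λ j →
           (i Fin.≤ j) × Fin (length (typ i)) × Fin (length (typ j))

  binTyp : BinIdx → List (Fin n)
  binTyp (i , j , _) = i ∷ j ∷ []

  binRel : (r : BinIdx) → All Qdom (binTyp r) → Bool
  binRel (i , j , _ , s , t) (a ∷ b ∷ []) = sameElem decEq (at (proj₁ a) s) (at (proj₁ b) t)

  QdecEq : ∀ i → DecidableEquality (Qdom i)
  QdecEq i (a , p) (b , q) with decEqAll decEq a b
  ... | yes refl = yes (cong (a ,_) (T-irrelevant p q))
  ... | no ne    = no λ e → ne (cong proj₁ e)

  binarize : MS BinIdx
  binarize = record
    { k             = n
    ; D             = Qdom
    ; decEq         = QdecEq
    ; enum          = λ i → Select.sel (R i) (enumAll enum (typ i))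
    ; enum-complete = λ i x → Select.sel-complete (R i) (proj₁ x) (proj₂ x)
                               (enumAll-complete enum enum-complete (typ i) (proj₁ x))
    ; enum-unique   = λ i → Select.sel-unique (R i) (enumAll-unique enum enum-unique (typ i))
    ; typ           = binTyp
    ; R             = binRel
    }

module _ {RI : Set} (H : MS RI) where
  open MS H
  open Tuples D

  DomainsAreRelations : Set
  DomainsAreRelations =
    ∀ i → Σ RI λ r → (typ r ≡ i ∷ []) × (∀ a → T (R r a))

  record IsMaltsev (f : ∀ i → D i → D i → D i → D i) : Set where
    field
      left  : ∀ i (a b : D i) → f i a a b ≡ b
      right : ∀ i (a b : D i) → f i b a a ≡ b
      pres  : ∀ r (x y z : All D (typ r)) →
              T (R r x) → T (R r y) → T (R r z) → T (R r (map3 f x y z))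

  HasMaltsev : Set
  HasMaltsev = Σ (∀ i → D i → D i → D i → D i) IsMaltsev

  record IsAutomorphism (π : ∀ i → D i → D i) : Set where
    field
      bijective : ∀ i → Bijective _≡_ _≡_ (π i)
      pres      : ∀ r (a : All D (typ r)) → R r (map1 π a) ≡ R r a

  iter : ∀ {A : Set} → ℕ → (A → A) → A → A
  iter zero    g x = x
  iter (suc m) g x = g (iter m g x)

  IsIdentity : ∀ {A : Set} → (A → A) → Set
  IsIdentity g = ∀ x → g x ≡ x

  HasOrder : ∀ {A : Set} → ℕ → (A → A) → Set
  HasOrder p g = IsIdentity (iter p g) ×
                 (∀ m → 1 ≤ m → m < p → ¬ IsIdentity (iter m g))

  OfOrder : ℕ → (∀ i → D i → D i) → Set
  OfOrder p π = (∀ i → IsIdentity (π i) ⊎ HasOrder p (π i)) ×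
                (∃ λ i → ¬ IsIdentity (π i))

  PRigid : ℕ → Set
  PRigid p = ¬ (Σ (∀ i → D i → D i) λ π → IsAutomorphism π × OfOrder p π)

  -- Formulas.  Variables are typed de Bruijn indices: a variable of
  -- sort i in context Γ is a proof of i ∈ Γ.
  data Atom (Γ : List (Fin k)) : Set where
    rel : (r : RI) → All (_∈ Γ) (typ r) → Atom Γ
    eq  : ∀ {i} → i ∈ Γ → i ∈ Γ → Atom Γ

  data MppFormula (Γ : List (Fin k)) : Set where
    qf  : List (Atom Γ) → MppFormula Γ
    ∃≢p : (Y : List (Fin k)) → MppFormula (Γ ++ Y) → MppFormula Γ

  evalAtom : ∀ {Γ} → Atom Γ → All D Γ → Bool
  evalAtom (rel r σ) ρ = R r (All.map (All.lookup ρ) σ)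
  evalAtom (eq u v)  ρ = ⌊ decEq _ (All.lookup ρ u) (All.lookup ρ v) ⌋

  countTrue : ∀ {A : Set} → (A → Bool) → List A → ℕ
  countTrue P []       = 0
  countTrue P (x ∷ xs) = (if P x then 1 else 0) ℕ.+ countTrue P xs

  eval : (p : ℕ) → ∀ {Γ} → MppFormula Γ → All D Γ → Bool
  eval p (qf φ)    ρ = allTrue φ
    where
    allTrue : List (Atom _) → Bool
    allTrue []       = true
    allTrue (α ∷ αs) = evalAtom α ρ Data.Bool.∧ allTrue αs
  eval p (∃≢p Y ψ) ρ =
    not ⌊ p ∣? countTrue (λ b → eval p ψ (AllP.++⁺ ρ b)) (enumAll enum Y) ⌋

  MppDefinable : ℕ → ∀ {Δ} → (All D Δ → Bool) → Set
  MppDefinable p {Δ} S = Σ (MppFormula Δ) λ ψ → ∀ a → eval p ψ a ≡ S a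

  AgreeOn : ∀ {Δ} → Subset (length Δ) → All D Δ → All D Δ → Set
  AgreeOn I x y = ∀ s → s ∈ₛ I → at x s ≡ at y s

  -- rectangularity, with (a,c)=x, (a,d)=y, (b,c)=z, (b,d)=w
  Rectangular : ∀ {Δ} → (All D Δ → Bool) → Set
  Rectangular {Δ} S =
    ∀ (I : Subset (length Δ)) → Nonempty I → Nonempty (∁ I) →
    ∀ (x y z w : All D Δ) → T (S x) → T (S y) → T (S z) →
    AgreeOn I x y → AgreeOn (∁ I) x z →
    AgreeOn I w z → AgreeOn (∁ I) w y → T (S w)

  StronglyRectangular : ℕ → Set
  StronglyRectangular p =
    ∀ (Δ : List (Fin k)) (S : All D Δ → Bool) →
    2 ≤ length Δ → MppDefinable p S → Rectangular S

-- Each sort H_i is itself a relation Q_r of H, so H_i ≅ Q_r through unary tuples, and for a ∈ Q_j the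
-- relation R^{rj}_{1s} ties the s-th entry of a to that unary tuple.  Hence every family of operations of
-- b(H) compatible with the binary relations acts on tuples coordinatewise, through the operations it
-- induces on the sorts H_i; conversely operations of H act on the Q_j coordinatewise.  This transfers
-- Mal'tsev polymorphisms and automorphisms in both directions.  Orders transfer by conjugating with
-- H_i ≅ Q_r, and since p is prime, a coordinatewise map whose p-th iterate and m-th iterate, 0 < m < p,
-- are both trivial is trivial itself.  For (3), a p-mpp formula over b(H) becomes one over H by replacing each variable
-- of sort j by a block of variables constrained to lie in Q_j and each atom R^{ij}_{st} by an equality.
-- The witnesses of the new formula are exactly the flattenings of the old ones, so the counts modulo p
-- agree, every p-mpp-definable relation of b(H) is a flattened p-mpp-definable relation of H, and
-- rectangularity transfers along the flattened partition of coordinates.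

module Submission where

open import Defs
open import Data.Bool using (Bool; true; false; T; not; _∧_)
open import Data.Bool.Properties using (T-irrelevant; T-∧; T-≡; ∧-assoc; ∧-zeroʳ; ∧-identityʳ)
open import Data.Empty using (⊥-elim)
open import Data.Unit using (⊤; tt)
open import Data.Fin as Fin using (Fin; zero; suc)
open import Data.Fin.Properties as Finₚ using (¬∀⟶∃¬)
open import Data.Fin.Subset using (Subset; ∁; Nonempty)
open import Data.Fin.Subset.Properties using (x∉p⇒x∈∁p; nonempty?) renaming (_∈?_ to _∈ₛ?_)
open import Data.Vec using ([]; _∷_; here; there)
open import Data.List as List using (List; []; _∷_; _++_; length; filter; map)
open import Data.List.Properties using (length-map; filter-≐)
open import Data.List.Membership.Propositional using (_∈_)
open import Data.List.Membership.Propositional.Properties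
  using (∈-filter⁻; ∈-filter⁺; ∈-map∘filter⁻; ∈-map∘filter⁺; ∈-++⁺ˡ; ∈-++⁺ʳ)
open import Data.List.Membership.Propositional.Properties.WithK using (unique∧set⇒bag)
open import Data.List.Relation.Binary.BagAndSetEquality using (∼bag⇒↭)
open import Data.List.Relation.Binary.Permutation.Propositional.Properties using (↭-length)
open import Data.List.Relation.Unary.All as All using (All; []; _∷_)
import Data.List.Relation.Unary.All.Properties as AllP
open import Data.List.Relation.Unary.All.Properties using (map-∘; map-cong; lookup-map)
open import Data.List.Relation.Unary.Any using (here; there)
open import Data.List.Relation.Unary.Unique.Propositional using (Unique)
open import Data.List.Relation.Unary.Unique.Propositional.Properties using (filter⁺; map⁺)
open import Data.Nat using (ℕ; zero; suc; _+_; _*_; _≤_; _<_; s≤s; z≤n)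
open import Data.Nat.Coprimality using (prime⇒coprime; coprime-Bézout)
open import Data.Nat.Divisibility using (_∣?_; _∣0)
open import Data.Nat.GCD using (module Bézout)
open import Data.Nat.Primality using (Prime)
open import Data.Product using (∃; _×_; _,_; proj₁; proj₂)
open import Data.Sum using (_⊎_; inj₁; inj₂)
open import Function using (_∘_; case_of_; Injective; _⇔_; mk⇔; Equivalence; Inverse)
open import Relation.Nullary using (¬_; Dec; yes; no; ⌊_⌋)
open import Relation.Nullary.Decidable using (T?; toWitness; fromWitness)
open import Relation.Binary.Definitions using (DecidableEquality)
open import Relation.Binary.PropositionalEquality

T⇔⇒≡ : ∀ {a b : Bool} → T a ⇔ T b → a ≡ b
T⇔⇒≡ {true}  {true}  _   = refl
T⇔⇒≡ {true}  {false} a⇔b = ⊥-elim (Equivalence.to a⇔b _)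
T⇔⇒≡ {false} {true}  a⇔b = ⊥-elim (Equivalence.from a⇔b _)
T⇔⇒≡ {false} {false} _   = refl

¬T⇒≡false : ∀ {b : Bool} → ¬ T b → b ≡ false
¬T⇒≡false {true}  ¬t = ⊥-elim (¬t _)
¬T⇒≡false {false} _  = refl

not-∣?0 : ∀ p → not ⌊ p ∣? 0 ⌋ ≡ false
not-∣?0 p with p ∣? 0
... | yes _  = refl
... | no ∤0 = ⊥-elim (∤0 (p ∣0))

count : {A : Set} → (A → Bool) → List A → ℕ
count P xs = length (filter (λ x → T? (P x)) xs)

countTrue≡count : ∀ {RI} (K : MS RI) {A : Set} (P : A → Bool) xs → countTrue K P xs ≡ count P xs
countTrue≡count K P []       = refl
countTrue≡count K P (x ∷ xs) with P x
... | true  = cong suc (countTrue≡count K P xs)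
... | false = countTrue≡count K P xs

count-cong : {A : Set} {P P′ : A → Bool} → (∀ x → P x ≡ P′ x) → ∀ xs → count P xs ≡ count P′ xs
count-cong P≗P′ xs =
  cong length (filter-≐ (λ x → T? _) (λ x → T? _)
                        ((λ {x} → subst T (P≗P′ x)) , (λ {x} → subst T (sym (P≗P′ x)))) xs)

count-false : {A : Set} (xs : List A) → count (λ _ → false) xs ≡ 0
count-false []       = refl
count-false (_ ∷ xs) = count-false xs

∤count⇒∃ : {A : Set} (p : ℕ) (P : A → Bool) (xs : List A) →
           T (not ⌊ p ∣? count P xs ⌋) → ∃ λ x → T (P x)
∤count⇒∃ p P xs ∤ with filter (λ x → T? (P x)) xs in filter≡
... | []    = ⊥-elim (subst T (not-∣?0 p) ∤)
... | x ∷ _ = x , proj₂ (∈-filter⁻ (λ x → T? (P x)) {xs = xs} (subst (x ∈_) (sym filter≡) (here refl)))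

-- Both filtered lists are duplicate-free with the same members, hence permutations of each other.
count-reindex : {A B : Set} {f : B → A} → Injective _≡_ _≡_ f →
                (P : A → Bool) {xs : List A} {ys : List B} →
                Unique xs → (∀ x → x ∈ xs) → Unique ys → (∀ y → y ∈ ys) →
                (∀ x → T (P x) → ∃ λ y → f y ≡ x) → count P xs ≡ count (P ∘ f) ys
count-reindex {f = f} f-inj P {xs} {ys} xs! xs-complete ys! ys-complete onto = begin
  count P xs                               ≡⟨ ↭-length (∼bag⇒↭ (unique∧set⇒bag
                                                (filter⁺ P? xs!) (map⁺ f-inj (filter⁺ Pf? ys!)) (mk⇔ to from))) ⟩
  length (map f (filter Pf? ys))           ≡⟨ length-map f (filter Pf? ys) ⟩
  count (P ∘ f) ys                         ∎
  where
  open ≡-Reasoning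
  P? = λ x → T? (P x)
  Pf? = λ y → T? (P (f y))
  to : ∀ {x} → x ∈ filter P? xs → x ∈ map f (filter Pf? ys)
  to {x} x∈ with ∈-filter⁻ P? {xs = xs} x∈
  ... | _ , Px with onto x Px
  ...   | y , refl = ∈-map∘filter⁺ f Pf? {xs = ys} (y , ys-complete y , refl , Px)
  from : ∀ {x} → x ∈ map f (filter Pf? ys) → x ∈ filter P? xs
  from x∈ with ∈-map∘filter⁻ f Pf? {xs = ys} x∈
  ... | y , _ , refl , Pfy = ∈-filter⁺ P? (xs-complete (f y)) Pfy

module _ {A : Set} {P : A → Set} where

  lookup-++⁺ˡ : ∀ {xs ys} (a : All P xs) (b : All P ys) {x} (v : x ∈ xs) →
                All.lookup (AllP.++⁺ a b) (∈-++⁺ˡ v) ≡ All.lookup a v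
  lookup-++⁺ˡ (_ ∷ a) b (here refl) = refl
  lookup-++⁺ˡ (_ ∷ a) b (there v)   = lookup-++⁺ˡ a b v

  lookup-++⁺ʳ : ∀ {xs ys} (a : All P xs) (b : All P ys) {y} (v : y ∈ ys) →
                All.lookup (AllP.++⁺ a b) (∈-++⁺ʳ xs v) ≡ All.lookup b v
  lookup-++⁺ʳ []      b v = refl
  lookup-++⁺ʳ (_ ∷ a) b v = lookup-++⁺ʳ a b v

  map-++⁺ : ∀ {P′ : A → Set} (f : ∀ {x} → P x → P′ x) {xs ys} (a : All P xs) (b : All P ys) →
            All.map f (AllP.++⁺ a b) ≡ AllP.++⁺ (All.map f a) (All.map f b)
  map-++⁺ f []      b = refl
  map-++⁺ f (x ∷ a) b = cong (f x ∷_) (map-++⁺ f a b)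

firstBlock : ∀ {A : Set} (xs : List A) {ys} → All (_∈ xs ++ ys) xs
firstBlock []       = []
firstBlock (x ∷ xs) = here refl ∷ All.map there (firstBlock xs)

map-lookup-firstBlock : ∀ {A : Set} {P : A → Set} {xs ys} (a : All P xs) (b : All P ys) →
                        All.map (All.lookup (AllP.++⁺ a b)) (firstBlock xs) ≡ a
map-lookup-firstBlock []      b = refl
map-lookup-firstBlock (x ∷ a) b = cong (x ∷_) (trans (map-∘ (firstBlock _)) (map-lookup-firstBlock a b))

at-map : ∀ {k} {P D : Fin k → Set} (f : ∀ {i} → P i → D i) {Γ} (c : All P Γ) s →
         Tuples.at D (All.map f c) s ≡ f (Tuples.at P c s)
at-map f (x ∷ c) zero    = refl
at-map f (x ∷ c) (suc s) = at-map f c s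

Nonempty-∁⇒2≤ : ∀ {m} (J : Subset m) → Nonempty J → Nonempty (∁ J) → 2 ≤ m
Nonempty-∁⇒2≤ {suc zero}    (_ ∷ []) (zero , here) (zero , ())
Nonempty-∁⇒2≤ {suc (suc m)} _        _             _           = s≤s (s≤s z≤n)

module _ {RI : Set} (K : MS RI) where
  open MS K

  iter-+ : ∀ {A : Set} a b (g : A → A) x → iter K (a + b) g x ≡ iter K a g (iter K b g x)
  iter-+ zero    b g x = refl
  iter-+ (suc a) b g x = cong g (iter-+ a b g x)

  iter-*-fixed : ∀ {A : Set} a m (g : A → A) x → iter K m g x ≡ x → iter K (a * m) g x ≡ x
  iter-*-fixed zero    m g x gᵐx≡x = refl
  iter-*-fixed (suc a) m g x gᵐx≡x = begin
    iter K (m + a * m) g x          ≡⟨ iter-+ m (a * m) g x ⟩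
    iter K m g (iter K (a * m) g x) ≡⟨ cong (iter K m g) (iter-*-fixed a m g x gᵐx≡x) ⟩
    iter K m g x                    ≡⟨ gᵐx≡x ⟩
    x                               ∎
    where open ≡-Reasoning

  -- By Bézout, 1 + z·m = x·p or 1 + x·p = z·m, so g y is an iterate of y of the form g^(z·m) or g^(x·p).
  fixed-by-coprime-iterates : ∀ {A : Set} {p m} → Prime p → 1 ≤ m → m < p → (g : A → A) (y : A) →
                              iter K m g y ≡ y → iter K p g y ≡ y → g y ≡ y
  fixed-by-coprime-iterates {p = p} {suc m} p-prime (s≤s _) m<p g y gᵐy≡y gᵖy≡y
    with coprime-Bézout (prime⇒coprime p-prime m<p)
  ... | Bézout.+- x z eqn = trans (cong g (sym (iter-*-fixed z (suc m) g y gᵐy≡y)))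
                              (trans (cong (λ e → iter K e g y) eqn) (iter-*-fixed x p g y gᵖy≡y))
  ... | Bézout.-+ x z eqn = trans (cong g (sym (iter-*-fixed x p g y gᵖy≡y)))
                              (trans (cong (λ e → iter K e g y) eqn) (iter-*-fixed z (suc m) g y gᵐy≡y))

  identity-or-order⇒iter-identity : ∀ {A : Set} {p} {g : A → A} →
                                    IsIdentity K g ⊎ HasOrder K p g → IsIdentity K (iter K p g)
  identity-or-order⇒iter-identity {p = p} {g} (inj₁ g≗id) = iter-id p
    where
    iter-id : ∀ m → IsIdentity K (iter K m g)
    iter-id zero    x = refl
    iter-id (suc m) x = trans (g≗id _) (iter-id m x)
  identity-or-order⇒iter-identity (inj₂ (gᵖ≗id , _)) = gᵖ≗id

  isIdentity? : ∀ i (g : D i → D i) → Dec (IsIdentity K g)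
  isIdentity? i g with All.all? (λ x → decEq i (g x) x) (enum i)
  ... | yes fixed = yes (λ x → All.lookup fixed (enum-complete i x))
  ... | no ¬fixed = no (λ g≗id → ¬fixed (All.tabulate (λ {x} _ → g≗id x)))

module _ {RI RI′ : Set} (K : MS RI) (K′ : MS RI′) {A B : Set} {g : A → A} {h : B → B}
         (φ : B → A) (φh≗gφ : ∀ y → φ (h y) ≡ g (φ y)) where

  iter-intertwine : ∀ m y → φ (iter K′ m h y) ≡ iter K m g (φ y)
  iter-intertwine zero    y = refl
  iter-intertwine (suc m) y = trans (φh≗gφ _) (cong g (iter-intertwine m y))

  module _ (φ-inj : Injective _≡_ _≡_ φ) (ψ : A → B) (φψ≗id : ∀ x → φ (ψ x) ≡ x) where

    iter-identity-conjugate : ∀ m → IsIdentity K (iter K m g) ⇔ IsIdentity K′ (iter K′ m h)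
    iter-identity-conjugate m = mk⇔
      (λ gᵐ≗id y → φ-inj (trans (iter-intertwine m y) (gᵐ≗id (φ y))))
      (λ hᵐ≗id x → begin
        iter K m g x          ≡⟨ cong (iter K m g) (sym (φψ≗id x)) ⟩
        iter K m g (φ (ψ x))  ≡⟨ sym (iter-intertwine m (ψ x)) ⟩
        φ (iter K′ m h (ψ x)) ≡⟨ cong φ (hᵐ≗id (ψ x)) ⟩
        φ (ψ x)               ≡⟨ φψ≗id x ⟩
        x                     ∎)
      where open ≡-Reasoning

    identity-or-order-conjugate : ∀ p → IsIdentity K′ h ⊎ HasOrder K′ p h → IsIdentity K g ⊎ HasOrder K p g
    identity-or-order-conjugate p (inj₁ h≗id) = inj₁ (Equivalence.from (iter-identity-conjugate 1) h≗id)
    identity-or-order-conjugate p (inj₂ (hᵖ≗id , h-minimal)) =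
      inj₂ ( Equivalence.from (iter-identity-conjugate p) hᵖ≗id
           , λ m 1≤m m<p gᵐ≗id → h-minimal m 1≤m m<p (Equivalence.to (iter-identity-conjugate m) gᵐ≗id))

module TupleProperties {k : ℕ} {D : Fin k → Set} where
  open Tuples D

  ∷-injective : ∀ {i Γ} {x y : D i} {a b : All D Γ} →
                _≡_ {A = All D (i ∷ Γ)} (x ∷ a) (y ∷ b) → x ≡ y × a ≡ b
  ∷-injective refl = refl , refl

  at-ext : ∀ {Γ} {a b : All D Γ} → (∀ s → at a s ≡ at b s) → a ≡ b
  at-ext {a = []}    {[]}    _    = refl
  at-ext {a = x ∷ a} {y ∷ b} a≗b = cong₂ _∷_ (a≗b zero) (at-ext (a≗b ∘ suc))

  at-map1 : ∀ π {Γ} (a : All D Γ) s → at (map1 π a) s ≡ π _ (at a s)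
  at-map1 π (x ∷ a) zero    = refl
  at-map1 π (x ∷ a) (suc s) = at-map1 π a s

  at-map3 : ∀ f {Γ} (a b c : All D Γ) s → at (map3 f a b c) s ≡ f _ (at a s) (at b s) (at c s)
  at-map3 f (x ∷ a) (y ∷ b) (z ∷ c) zero    = refl
  at-map3 f (x ∷ a) (y ∷ b) (z ∷ c) (suc s) = at-map3 f a b c s

  map3-left : ∀ {f} → (∀ i x y → f i x x y ≡ y) → ∀ {Γ} (a b : All D Γ) → map3 f a a b ≡ b
  map3-left f-left []      []      = refl
  map3-left f-left (x ∷ a) (y ∷ b) = cong₂ _∷_ (f-left _ x y) (map3-left f-left a b)

  map3-right : ∀ {f} → (∀ i x y → f i y x x ≡ y) → ∀ {Γ} (a b : All D Γ) → map3 f b a a ≡ b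
  map3-right f-right []      []      = refl
  map3-right f-right (x ∷ a) (y ∷ b) = cong₂ _∷_ (f-right _ x y) (map3-right f-right a b)

  map3-first : ∀ π {Γ} (a b c : All D Γ) → map3 (λ i x _ _ → π i x) a b c ≡ map1 π a
  map3-first π []      []      []      = refl
  map3-first π (x ∷ a) (_ ∷ b) (_ ∷ c) = cong (π _ x ∷_) (map3-first π a b c)

  map1-identity : ∀ {π} → (∀ i x → π i x ≡ x) → ∀ {Γ} (a : All D Γ) → map1 π a ≡ a
  map1-identity π≗id []      = refl
  map1-identity π≗id (x ∷ a) = cong₂ _∷_ (π≗id _ x) (map1-identity π≗id a)

  map1-injective : ∀ {π} → (∀ i → Injective _≡_ _≡_ (π i)) → ∀ {Γ} → Injective _≡_ _≡_ (map1 π {Γ})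
  map1-injective π-inj {x = []}    {[]}    _  = refl
  map1-injective π-inj {x = x ∷ a} {y ∷ b} πxa≡πyb with ∷-injective πxa≡πyb
  ... | πx≡πy , πa≡πb = cong₂ _∷_ (π-inj _ πx≡πy) (map1-injective π-inj πa≡πb)

  map1-surjective : ∀ {π} → (∀ i y → ∃ λ x → π i x ≡ y) →
                    ∀ {Γ} (b : All D Γ) → ∃ λ a → map1 π a ≡ b
  map1-surjective π-surj []      = [] , refl
  map1-surjective π-surj (y ∷ b) with π-surj _ y | map1-surjective π-surj b
  ... | x , refl | a , refl = x ∷ a , refl

  data Same : ∀ {i j} → D i → D j → Set where
    same : ∀ {i} (x : D i) → Same x x

  Same-sym : ∀ {i j} {x : D i} {y : D j} → Same x y → Same y x
  Same-sym (same x) = same x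

  Same-trans : ∀ {i j l} {x : D i} {y : D j} {z : D l} → Same x y → Same y z → Same x z
  Same-trans (same x) (same x) = same x

  Same⇒≡ : ∀ {i} {x y : D i} → Same x y → x ≡ y
  Same⇒≡ (same x) = refl

  Same-sort : ∀ {i j} {x : D i} {y : D j} → Same x y → i ≡ j
  Same-sort (same x) = refl

  module _ (decEq : ∀ i → DecidableEquality (D i)) where

    sameElem⇔Same : ∀ {i j} {x : D i} {y : D j} → T (sameElem decEq x y) ⇔ Same x y
    sameElem⇔Same {i} {j} {x} {y} = mk⇔ to from
      where
      to : T (sameElem decEq x y) → Same x y
      to t with i Fin.≟ j
      ... | no _ = ⊥-elim t
      ... | yes refl with decEq i x y
      ...   | yes refl = same x
      ...   | no _     = ⊥-elim t
      from : Same x y → T (sameElem decEq x y)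
      from (same x) with i Fin.≟ i
      ... | no i≢i = i≢i refl
      ... | yes refl with decEq i x x
      ...   | yes _   = _
      ...   | no x≢x = x≢x refl

    sameElem-≡ : ∀ {i} (x y : D i) → sameElem decEq x y ≡ ⌊ decEq i x y ⌋
    sameElem-≡ {i} x y with i Fin.≟ i
    ... | yes refl = refl
    ... | no i≢i   = ⊥-elim (i≢i refl)

  module _ {i : Fin k} where

    unwrap : ∀ {Γ} → Γ ≡ i ∷ [] → All D Γ → D i
    unwrap refl (x ∷ []) = x

    wrap : ∀ {Γ} → Γ ≡ i ∷ [] → D i → All D Γ
    wrap refl x = x ∷ []

    unwrap-wrap : ∀ {Γ} (e : Γ ≡ i ∷ []) x → unwrap e (wrap e x) ≡ x
    unwrap-wrap refl x = refl

    wrap-unwrap : ∀ {Γ} (e : Γ ≡ i ∷ []) a → wrap e (unwrap e a) ≡ a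
    wrap-unwrap refl (x ∷ []) = refl

    unwrap-map1 : ∀ π {Γ} (e : Γ ≡ i ∷ []) x → unwrap e (map1 π (wrap e x)) ≡ π i x
    unwrap-map1 π refl x = refl

    onlyIndex : ∀ {Γ} → Γ ≡ i ∷ [] → Fin (length Γ)
    onlyIndex refl = zero

    Same-at-onlyIndex : ∀ {Γ} (e : Γ ≡ i ∷ []) a → Same (at a (onlyIndex e)) (unwrap e a)
    Same-at-onlyIndex refl (x ∷ []) = same x

    Same-at-onlyIndex-wrap : ∀ {Γ} (e : Γ ≡ i ∷ []) x → Same (at (wrap e x) (onlyIndex e)) x
    Same-at-onlyIndex-wrap refl x = same x

  Same-map : ∀ (π : ∀ i → D i → D i) {i j} {x : D i} {y : D j} → Same x y → Same (π i x) (π j y)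
  Same-map π (same x) = same _

  Same-unmap : ∀ {π : ∀ i → D i → D i} → (∀ i → Injective _≡_ _≡_ (π i)) →
               ∀ {i j} {x : D i} {y : D j} → Same (π i x) (π j y) → Same x y
  Same-unmap π-inj πx~πy with Same-sort πx~πy
  ... | refl with π-inj _ (Same⇒≡ πx~πy)
  ...   | refl = same _

module _ {RI : Set} (K : MS RI) where
  open MS K
  open Tuples D

  eval-qf-++ : ∀ p {Δ} (φ ψ : List (Atom K Δ)) ρ →
               eval K p (qf (φ ++ ψ)) ρ ≡ eval K p (qf φ) ρ ∧ eval K p (qf ψ) ρ
  eval-qf-++ p []      ψ ρ = refl
  eval-qf-++ p (α ∷ φ) ψ ρ = trans (cong (evalAtom K α ρ ∧_) (eval-qf-++ p φ ψ ρ))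
                               (sym (∧-assoc (evalAtom K α ρ) (eval K p (qf φ) ρ) (eval K p (qf ψ) ρ)))

  AgreeOn-∁⇒≡ : ∀ {Δ} (J : Subset (length Δ)) {a b : All D Δ} →
                AgreeOn K J a b → AgreeOn K (∁ J) a b → a ≡ b
  AgreeOn-∁⇒≡ J a~b a~∁b = TupleProperties.at-ext λ s → case s ∈ₛ? J of λ
    { (yes s∈J) → a~b s s∈J
    ; (no s∉J)  → a~∁b s (x∉p⇒x∈∁p s∉J)
    }

  AgreeOn-empty : ∀ {Δ} (J : Subset (length Δ)) {a b : All D Δ} → ¬ Nonempty J → AgreeOn K J a b
  AgreeOn-empty J J-empty s s∈J = ⊥-elim (J-empty (s , s∈J))

  empty⇒rectangular : ∀ {Δ} (S : All D Δ → Bool) → (∀ a → ¬ T (S a)) → Rectangular K S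
  empty⇒rectangular S S-empty _ _ _ x _ _ _ Sx _ _ _ _ _ _ = ⊥-elim (S-empty x Sx)

Preserves₃ : ∀ {RI} (K : MS RI) → (∀ i → MS.D K i → MS.D K i → MS.D K i → MS.D K i) → Set
Preserves₃ K f = ∀ r x y z → T (R r x) → T (R r y) → T (R r z) → T (R r (map3 f x y z))
  where open MS K
        open Tuples D

module Binarization {n : ℕ} (H : MS (Fin n)) where
  open MS H
  open Tuples D
  open TupleProperties {k} {D}

  bH : MS (BinIdx H)
  bH = binarize H

  Q : Fin n → Set
  Q = Qdom H

  Qdom-ext : ∀ {j} {q q′ : Q j} → proj₁ q ≡ proj₁ q′ → q ≡ q′
  Qdom-ext {q = a , _} refl = cong (a ,_) (T-irrelevant _ _)

  sameElem⇒Same : ∀ {i j} (x : D i) (y : D j) → T (sameElem decEq x y) → Same x y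
  sameElem⇒Same x y = Equivalence.to (sameElem⇔Same decEq {x = x} {y = y})

  Same⇒sameElem : ∀ {i j} {x : D i} {y : D j} → Same x y → T (sameElem decEq x y)
  Same⇒sameElem = Equivalence.from (sameElem⇔Same decEq)

  -- R^{ij}_{st} is only available for i ≤ j; the other orientation is its converse.
  preserves-Same : ∀ {g} → Preserves₃ bH g → ∀ {a b} s t (x₁ x₂ x₃ : Q a) (y₁ y₂ y₃ : Q b) →
                   Same (at (proj₁ x₁) s) (at (proj₁ y₁) t) → Same (at (proj₁ x₂) s) (at (proj₁ y₂) t) →
                   Same (at (proj₁ x₃) s) (at (proj₁ y₃) t) →
                   Same (at (proj₁ (g a x₁ x₂ x₃)) s) (at (proj₁ (g b y₁ y₂ y₃)) t)
  preserves-Same g-pres {a} {b} s t x₁ x₂ x₃ y₁ y₂ y₃ x₁~y₁ x₂~y₂ x₃~y₃ with Finₚ.≤-total a b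
  ... | inj₁ a≤b = sameElem⇒Same _ _
    (g-pres (a , b , a≤b , s , t) (x₁ ∷ y₁ ∷ []) (x₂ ∷ y₂ ∷ []) (x₃ ∷ y₃ ∷ [])
      (Same⇒sameElem x₁~y₁) (Same⇒sameElem x₂~y₂)
      (Same⇒sameElem x₃~y₃))
  ... | inj₂ b≤a = Same-sym (sameElem⇒Same _ _
    (g-pres (b , a , b≤a , t , s) (y₁ ∷ x₁ ∷ []) (y₂ ∷ x₂ ∷ []) (y₃ ∷ x₃ ∷ [])
      (Same⇒sameElem (Same-sym x₁~y₁)) (Same⇒sameElem (Same-sym x₂~y₂))
      (Same⇒sameElem (Same-sym x₃~y₃))))

  maltsev⇒binarize-maltsev : HasMaltsev H → HasMaltsev bH
  maltsev⇒binarize-maltsev (f , f-maltsev) = g , record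
    { left  = λ j a b → Qdom-ext (map3-left left (proj₁ a) (proj₁ b))
    ; right = λ j a b → Qdom-ext (map3-right right (proj₁ a) (proj₁ b))
    ; pres  = g-pres
    }
    where
    open IsMaltsev f-maltsev
    g : ∀ j → Q j → Q j → Q j → Q j
    g j a b c = map3 f (proj₁ a) (proj₁ b) (proj₁ c) , pres j _ _ _ (proj₂ a) (proj₂ b) (proj₂ c)
    f-Same : ∀ {i j} {a₁ a₂ a₃ : D i} {b₁ b₂ b₃ : D j} → Same a₁ b₁ → Same a₂ b₂ → Same a₃ b₃ →
             Same (f i a₁ a₂ a₃) (f j b₁ b₂ b₃)
    f-Same (same _) (same _) (same _) = same _
    g-pres : Preserves₃ bH g
    g-pres (i , j , _ , s , t) (x₁ ∷ x₂ ∷ []) (y₁ ∷ y₂ ∷ []) (z₁ ∷ z₂ ∷ []) x₁~x₂ y₁~y₂ z₁~z₂ =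
      Same⇒sameElem (subst₂ Same
        (sym (at-map3 f (proj₁ x₁) (proj₁ y₁) (proj₁ z₁) s))
        (sym (at-map3 f (proj₁ x₂) (proj₁ y₂) (proj₁ z₂) t))
        (f-Same (sameElem⇒Same (at (proj₁ x₁) s) (at (proj₁ x₂) t) x₁~x₂)
                (sameElem⇒Same (at (proj₁ y₁) s) (at (proj₁ y₂) t) y₁~y₂)
                (sameElem⇒Same (at (proj₁ z₁) s) (at (proj₁ z₂) t) z₁~z₂)))

  lift : ∀ {π} → IsAutomorphism H π → ∀ j → Q j → Q j
  lift {π} π-aut j q = map1 π (proj₁ q) , subst T (sym (IsAutomorphism.pres π-aut j (proj₁ q))) (proj₂ q)

  lift-automorphism : ∀ {π} (π-aut : IsAutomorphism H π) → IsAutomorphism bH (lift π-aut)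
  lift-automorphism {π} π-aut = record
    { bijective = λ j → lift-injective j , lift-surjective j
    ; pres      = lift-pres
    }
    where
    open IsAutomorphism π-aut
    π-injective : ∀ i → Injective _≡_ _≡_ (π i)
    π-injective i = proj₁ (bijective i)
    lift-injective : ∀ j → Injective _≡_ _≡_ (lift π-aut j)
    lift-injective j πq≡πq′ = Qdom-ext (map1-injective π-injective (cong proj₁ πq≡πq′))
    lift-surjective : ∀ j (q : Q j) → ∃ λ q′ → ∀ {q″} → q″ ≡ q′ → lift π-aut j q″ ≡ q
    π-surjective : ∀ i y → ∃ λ x → π i x ≡ y
    π-surjective i y = proj₁ (proj₂ (bijective i) y) , proj₂ (proj₂ (bijective i) y) refl
    lift-surjective j (b , Rb) with map1-surjective π-surjective b
    ... | a , πa≡b = (a , subst T (trans (cong (R j) (sym πa≡b)) (pres j a)) Rb) , λ { refl → Qdom-ext πa≡b }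
    lift-pres : ∀ r (a : All Q (binTyp H r)) → binRel H r (Tuples.map1 Q (lift π-aut) a) ≡ binRel H r a
    lift-pres (_ , _ , _ , s , t) ((x , _) ∷ (y , _) ∷ []) = T⇔⇒≡ (mk⇔
      (λ πx~πy → Same⇒sameElem (Same-unmap π-injective
        (subst₂ Same (at-map1 π x s) (at-map1 π y t) (sameElem⇒Same (at (map1 π x) s) (at (map1 π y) t) πx~πy))))
      (λ x~y → Same⇒sameElem (subst₂ Same (sym (at-map1 π x s)) (sym (at-map1 π y t))
        (Same-map π (sameElem⇒Same (at x s) (at y t) x~y)))))

  module _ (domains : DomainsAreRelations H) where

    domRel : Fin k → Fin n
    domRel i = proj₁ (domains i)

    domRel-typ : ∀ i → typ (domRel i) ≡ i ∷ []
    domRel-typ i = proj₁ (proj₂ (domains i))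

    embed : ∀ i → D i → Q (domRel i)
    embed i x = wrap (domRel-typ i) x , proj₂ (proj₂ (domains i)) _

    project : ∀ i → Q (domRel i) → D i
    project i q = unwrap (domRel-typ i) (proj₁ q)

    project-embed : ∀ i x → project i (embed i x) ≡ x
    project-embed i = unwrap-wrap (domRel-typ i)

    embed-project : ∀ i q → embed i (project i q) ≡ q
    embed-project i q = Qdom-ext (wrap-unwrap (domRel-typ i) (proj₁ q))

    project-injective : ∀ i → Injective _≡_ _≡_ (project i)
    project-injective i {q} {q′} pq≡pq′ = begin
      q                      ≡⟨ sym (embed-project i q) ⟩
      embed i (project i q)  ≡⟨ cong (embed i) pq≡pq′ ⟩
      embed i (project i q′) ≡⟨ embed-project i q′ ⟩
      q′                     ∎
      where open ≡-Reasoning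

    induced : (∀ j → Q j → Q j → Q j → Q j) → ∀ i → D i → D i → D i → D i
    induced g i x y z = project i (g (domRel i) (embed i x) (embed i y) (embed i z))

    -- Coordinate s of a tuple of Q_j is tied to the unary relation of its sort by R^{·j}_{1s}.
    preserves⇒coordinatewise : ∀ {g} → Preserves₃ bH g → ∀ j (x y z : Q j) →
                               map3 (induced g) (proj₁ x) (proj₁ y) (proj₁ z) ≡ proj₁ (g j x y z)
    preserves⇒coordinatewise {g} g-pres j x y z = at-ext λ s →
      let i = List.lookup (typ j) s
          e = domRel-typ i
          G = g (domRel i) (embed i (at (proj₁ x) s)) (embed i (at (proj₁ y) s)) (embed i (at (proj₁ z) s))
      in trans (at-map3 (induced g) (proj₁ x) (proj₁ y) (proj₁ z) s)
           (Same⇒≡ (Same-trans (Same-sym (Same-at-onlyIndex e (proj₁ G)))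
             (preserves-Same g-pres (onlyIndex e) s _ _ _ x y z
               (Same-at-onlyIndex-wrap e _) (Same-at-onlyIndex-wrap e _) (Same-at-onlyIndex-wrap e _))))

    binarize-maltsev⇒maltsev : HasMaltsev bH → HasMaltsev H
    binarize-maltsev⇒maltsev (g , g-maltsev) = induced g , record
      { left  = λ i x y → trans (cong (project i) (left _ _ _)) (project-embed i y)
      ; right = λ i x y → trans (cong (project i) (right _ _ _)) (project-embed i y)
      ; pres  = λ j x y z Rx Ry Rz →
          subst (T ∘ R j) (sym (preserves⇒coordinatewise pres j (x , Rx) (y , Ry) (z , Rz)))
            (proj₂ (g j (x , Rx) (y , Ry) (z , Rz)))
      }
      where open IsMaltsev g-maltsev

    maltsev⇔binarize-maltsev : HasMaltsev H ⇔ HasMaltsev bH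
    maltsev⇔binarize-maltsev = mk⇔ maltsev⇒binarize-maltsev binarize-maltsev⇒maltsev

    restrict : (∀ j → Q j → Q j) → ∀ i → D i → D i
    restrict σ i x = project i (σ (domRel i) (embed i x))

    module _ {σ : ∀ j → Q j → Q j} (σ-aut : IsAutomorphism bH σ) where
      open IsAutomorphism σ-aut

      automorphism⇒coordinatewise : ∀ j q → map1 (restrict σ) (proj₁ q) ≡ proj₁ (σ j q)
      automorphism⇒coordinatewise j q =
        trans (sym (map3-first (restrict σ) (proj₁ q) (proj₁ q) (proj₁ q)))
              (preserves⇒coordinatewise σ-preserves₃ j q q q)
        where
        σ-preserves₃ : Preserves₃ bH (λ j x _ _ → σ j x)
        σ-preserves₃ r x y z Rx _ _ =
          subst T (sym (trans (cong (binRel H r) (TupleProperties.map3-first σ x y z)) (pres r x))) Rx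

      restrict-injective : ∀ i → Injective _≡_ _≡_ (restrict σ i)
      restrict-injective i {x} {y} σx≡σy = begin
        x                    ≡⟨ sym (project-embed i x) ⟩
        project i (embed i x) ≡⟨ cong (project i) (proj₁ (bijective (domRel i)) (project-injective i σx≡σy)) ⟩
        project i (embed i y) ≡⟨ project-embed i y ⟩
        y                    ∎
        where open ≡-Reasoning

      restrict-surjective : ∀ i y → ∃ λ x → ∀ {x′} → x′ ≡ x → restrict σ i x′ ≡ y
      restrict-surjective i y with proj₂ (bijective (domRel i)) (embed i y)
      ... | q , σq≡ey = project i q , λ { refl → begin
        project i (σ (domRel i) (embed i (project i q))) ≡⟨ cong (project i ∘ σ (domRel i)) (embed-project i q) ⟩
        project i (σ (domRel i) q)                       ≡⟨ cong (project i) (σq≡ey refl) ⟩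
        project i (embed i y)                            ≡⟨ project-embed i y ⟩
        y                                                ∎ }
        where open ≡-Reasoning

      restrict-automorphism : IsAutomorphism H (restrict σ)
      restrict-automorphism = record
        { bijective = λ i → restrict-injective i , restrict-surjective i
        ; pres      = λ j a → T⇔⇒≡ (mk⇔ (reflect j a) (λ Ra → subst (T ∘ R j)
                        (sym (automorphism⇒coordinatewise j (a , Ra))) (proj₂ (σ j (a , Ra)))))
        }
        where
        reflect : ∀ j a → T (R j (map1 (restrict σ) a)) → T (R j a)
        reflect j a R[πa] with proj₂ (bijective j) (map1 (restrict σ) a , R[πa])
        ... | q , σq≡πa = subst (T ∘ R j) (map1-injective restrict-injective
              (trans (automorphism⇒coordinatewise j q) (cong proj₁ (σq≡πa refl)))) (proj₂ q)

      restrict-order : ∀ p → OfOrder bH p σ → OfOrder H p (restrict σ)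
      restrict-order p (σ-each , j , σj≢id) =
        each , ¬∀⟶∃¬ k (λ i → IsIdentity H (restrict σ i)) (λ i → isIdentity? H i (restrict σ i)) not-all-id
        where
        each : ∀ i → IsIdentity H (restrict σ i) ⊎ HasOrder H p (restrict σ i)
        each i = identity-or-order-conjugate H bH {g = restrict σ i} {h = σ (domRel i)} (project i)
                   (λ q → cong (project i ∘ σ (domRel i)) (sym (embed-project i q)))
                   (project-injective i) (embed i) (project-embed i) p (σ-each (domRel i))
        not-all-id : ¬ (∀ i → IsIdentity H (restrict σ i))
        not-all-id all-id = σj≢id λ q →
          Qdom-ext (trans (sym (automorphism⇒coordinatewise j q)) (map1-identity all-id (proj₁ q)))

    lift-order : ∀ p → Prime p → ∀ {π} (π-aut : IsAutomorphism H π) → OfOrder H p π → OfOrder bH p (lift π-aut)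
    lift-order p p-prime {π} π-aut (π-each , i , πi≢id) = each , domRel i , lift-nontrivial
      where
      iter-at : ∀ j m q s → at (proj₁ (iter bH m (lift π-aut j) q)) s ≡ iter H m (π _) (at (proj₁ q) s)
      iter-at j m q s = iter-intertwine H bH (λ q → at (proj₁ q) s) (λ q → at-map1 π (proj₁ q) s) m q
      πᵖ≗id : ∀ i → IsIdentity H (iter H p (π i))
      πᵖ≗id i = identity-or-order⇒iter-identity H (π-each i)
      liftᵖ≗id : ∀ j → IsIdentity bH (iter bH p (lift π-aut j))
      liftᵖ≗id j q = Qdom-ext (at-ext λ s → trans (iter-at j p q s) (πᵖ≗id _ _))
      lift-minimal : ∀ j m → 1 ≤ m → m < p →
                     IsIdentity bH (iter bH m (lift π-aut j)) → IsIdentity bH (lift π-aut j)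
      lift-minimal j m 1≤m m<p liftᵐ≗id q = Qdom-ext (at-ext λ s →
        trans (at-map1 π (proj₁ q) s)
          (fixed-by-coprime-iterates H p-prime 1≤m m<p (π _) _
            (trans (sym (iter-at j m q s)) (cong (λ w → at (proj₁ w) s) (liftᵐ≗id q))) (πᵖ≗id _ _)))
      each : ∀ j → IsIdentity bH (lift π-aut j) ⊎ HasOrder bH p (lift π-aut j)
      each j with isIdentity? bH j (lift π-aut j)
      ... | yes lift≗id = inj₁ lift≗id
      ... | no lift≢id  = inj₂ (liftᵖ≗id j , λ m 1≤m m<p → lift≢id ∘ lift-minimal j m 1≤m m<p)
      lift-nontrivial : ¬ IsIdentity bH (lift π-aut (domRel i))
      lift-nontrivial lift≗id = πi≢id λ x → begin
        π i x                                            ≡⟨ sym (unwrap-map1 π (domRel-typ i) x) ⟩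
        project i (lift π-aut (domRel i) (embed i x))    ≡⟨ cong (project i) (lift≗id (embed i x)) ⟩
        project i (embed i x)                            ≡⟨ project-embed i x ⟩
        x                                                ∎
        where open ≡-Reasoning

    rigid⇔binarize-rigid : ∀ p → Prime p → PRigid H p ⇔ PRigid bH p
    rigid⇔binarize-rigid p p-prime = mk⇔
      (λ H-rigid (σ , σ-aut , σ-order) →
         H-rigid (restrict σ , restrict-automorphism σ-aut , restrict-order σ-aut p σ-order))
      (λ bH-rigid (π , π-aut , π-order) →
         bH-rigid (lift π-aut , lift-automorphism π-aut , lift-order p p-prime π-aut π-order))

  Blockwise : List (Fin n) → Set
  Blockwise Γ = All (λ j → All D (typ j)) Γ

  flatCtx : List (Fin n) → List (Fin k)
  flatCtx []      = []
  flatCtx (j ∷ Γ) = typ j ++ flatCtx Γ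

  concatBlocks : ∀ {Γ} → Blockwise Γ → All D (flatCtx Γ)
  concatBlocks []       = []
  concatBlocks (a ∷ as) = AllP.++⁺ a (concatBlocks as)

  flatten : ∀ {Γ} → All Q Γ → All D (flatCtx Γ)
  flatten σ = concatBlocks (All.map proj₁ σ)

  -- Blocks Γ Δ assigns to each variable of sort j in Γ a tuple of variables of Δ of type typ j.
  Blocks : List (Fin n) → List (Fin k) → Set
  Blocks Γ Δ = All (λ j → All (_∈ Δ) (typ j)) Γ

  decode : ∀ {Γ Δ} → Blocks Γ Δ → All D Δ → Blockwise Γ
  decode e ρ = All.map (All.map (All.lookup ρ)) e

  Decodes : ∀ {Γ Δ} → Blocks Γ Δ → All D Δ → All Q Γ → Set
  Decodes e ρ σ = decode e ρ ≡ All.map proj₁ σ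

  renameBlocks : ∀ {Γ Δ Δ′} → (∀ {x} → x ∈ Δ → x ∈ Δ′) → Blocks Γ Δ → Blocks Γ Δ′
  renameBlocks h = All.map (All.map h)

  decode-rename : ∀ {Γ Δ Δ′} {h : ∀ {x} → x ∈ Δ → x ∈ Δ′} (ρ′ : All D Δ′) (ρ : All D Δ) →
                  (∀ {x} (v : x ∈ Δ) → All.lookup ρ′ (h v) ≡ All.lookup ρ v) →
                  (e : Blocks Γ Δ) → decode (renameBlocks h e) ρ′ ≡ decode e ρ
  decode-rename _ _ ρ′∘h≗ρ e = trans (map-∘ e) (map-cong e λ c → trans (map-∘ c) (map-cong c ρ′∘h≗ρ))

  canonicalBlocks : ∀ Γ → Blocks Γ (flatCtx Γ)
  canonicalBlocks []      = []
  canonicalBlocks (j ∷ Γ) = firstBlock (typ j) ∷ renameBlocks (∈-++⁺ʳ (typ j)) (canonicalBlocks Γ)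

  decode-canonical : ∀ {Γ} (as : Blockwise Γ) → decode (canonicalBlocks Γ) (concatBlocks as) ≡ as
  decode-canonical []       = refl
  decode-canonical (a ∷ as) = cong₂ _∷_ (map-lookup-firstBlock a (concatBlocks as))
    (trans (decode-rename (AllP.++⁺ a (concatBlocks as)) (concatBlocks as) (lookup-++⁺ʳ a (concatBlocks as))
                          (canonicalBlocks _))
           (decode-canonical as))

  concat-decode-canonical : ∀ Γ (b : All D (flatCtx Γ)) → concatBlocks (decode (canonicalBlocks Γ) b) ≡ b
  concat-decode-canonical []      []  = refl
  concat-decode-canonical (j ∷ Γ) b
    with AllP.++⁻ (typ j) b | Inverse.strictlyInverseˡ (AllP.++↔ {xs = typ j}) b
  ... | a , c | refl = cong₂ AllP.++⁺ (map-lookup-firstBlock a c)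
    (trans (cong concatBlocks (decode-rename (AllP.++⁺ a c) c (lookup-++⁺ʳ a c) (canonicalBlocks Γ)))
           (concat-decode-canonical Γ c))

  flatten-injective : ∀ {Γ} → Injective _≡_ _≡_ (flatten {Γ})
  flatten-injective {Γ} {σ} {σ′} σ♭≡σ′♭ = map-proj₁-injective σ σ′
    (trans (sym (decode-canonical (All.map proj₁ σ)))
      (trans (cong (decode (canonicalBlocks Γ)) σ♭≡σ′♭) (decode-canonical (All.map proj₁ σ′))))
    where
    map-proj₁-injective : ∀ {Γ} (σ σ′ : All Q Γ) → All.map proj₁ σ ≡ All.map proj₁ σ′ → σ ≡ σ′
    map-proj₁-injective []      []        _   = refl
    map-proj₁-injective (q ∷ σ) (q′ ∷ σ′) qσ≡q′σ′ with TupleProperties.∷-injective qσ≡q′σ′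
    ... | q≡q′ , σ≡σ′ = cong₂ _∷_ (Qdom-ext q≡q′) (map-proj₁-injective σ σ′ σ≡σ′)

  extendBlocks : ∀ {Γ Δ} Y → Blocks Γ Δ → Blocks (Γ ++ Y) (Δ ++ flatCtx Y)
  extendBlocks {Δ = Δ} Y e = AllP.++⁺ (renameBlocks ∈-++⁺ˡ e) (renameBlocks (∈-++⁺ʳ Δ) (canonicalBlocks Y))

  decode-extend : ∀ {Γ Δ} Y (e : Blocks Γ Δ) ρ b →
                  decode (extendBlocks Y e) (AllP.++⁺ ρ b) ≡ AllP.++⁺ (decode e ρ) (decode (canonicalBlocks Y) b)
  decode-extend {Δ = Δ} Y e ρ b = trans (map-++⁺ (All.map (All.lookup (AllP.++⁺ ρ b)))
                                     (renameBlocks ∈-++⁺ˡ e) (renameBlocks (∈-++⁺ʳ Δ) (canonicalBlocks Y)))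
    (cong₂ AllP.++⁺ (decode-rename (AllP.++⁺ ρ b) ρ (lookup-++⁺ˡ ρ b) e)
                     (decode-rename (AllP.++⁺ ρ b) b (lookup-++⁺ʳ ρ b) (canonicalBlocks Y)))

  inRelations : ∀ {Γ} → Blockwise Γ → Bool
  inRelations []                = true
  inRelations {j ∷ Γ} (a ∷ as) = R j a ∧ inRelations as

  inRelations-++ : ∀ {Γ Y} (as : Blockwise Γ) (bs : Blockwise Y) →
                   inRelations (AllP.++⁺ as bs) ≡ inRelations as ∧ inRelations bs
  inRelations-++ []       bs = refl
  inRelations-++ {j ∷ Γ} (a ∷ as) bs =
    trans (cong (R j a ∧_) (inRelations-++ as bs)) (sym (∧-assoc (R j a) (inRelations as) (inRelations bs)))

  inRelations-proj₁ : ∀ {Γ} (σ : All Q Γ) → inRelations (All.map proj₁ σ) ≡ true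
  inRelations-proj₁ []            = refl
  inRelations-proj₁ ((a , Ra) ∷ σ) =
    trans (cong (_∧ inRelations (All.map proj₁ σ)) (Equivalence.to T-≡ Ra)) (inRelations-proj₁ σ)

  inRelations⇒lift : ∀ {Γ} (as : Blockwise Γ) → T (inRelations as) →
                     ∃ λ (σ : All Q Γ) → All.map proj₁ σ ≡ as
  inRelations⇒lift []       _   = [] , refl
  inRelations⇒lift {j ∷ Γ} (a ∷ as) Ras with Equivalence.to (T-∧ {R j a}) Ras
  ... | Ra , Ras′ with inRelations⇒lift as Ras′
  ...   | σ , σ≡as = (a , Ra) ∷ σ , cong (a ∷_) σ≡as

  eqAtoms : ∀ {Δ Θ} → All (_∈ Δ) Θ → All (_∈ Δ) Θ → List (Atom H Δ)
  eqAtoms []      []      = []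
  eqAtoms (u ∷ c) (v ∷ d) = eq u v ∷ eqAtoms c d

  sortedEqAtom : ∀ {Δ i j} → i ∈ Δ → j ∈ Δ → List (Atom H Δ)
  sortedEqAtom {i = i} {j} u v with i Fin.≟ j
  ... | yes refl = eq u v ∷ []
  ... | no _     = []

  membershipAtoms : ∀ {Γ Δ} → Blocks Γ Δ → List (Atom H Δ)
  membershipAtoms []              = []
  membershipAtoms {j ∷ Γ} (c ∷ e) = rel j c ∷ membershipAtoms e

  translateAtom : ∀ {Γ Δ} → Blocks Γ Δ → Atom bH Γ → List (Atom H Δ)
  translateAtom e (rel (_ , _ , _ , s , t) (u ∷ v ∷ [])) =
    sortedEqAtom (Tuples.at (_∈ _) (All.lookup e u) s) (Tuples.at (_∈ _) (All.lookup e v) t)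
  translateAtom e (eq u v) = eqAtoms (All.lookup e u) (All.lookup e v)

  translate : ∀ {Γ Δ} → Blocks Γ Δ → MppFormula bH Γ → MppFormula H Δ
  translate e (qf φ)    = qf (membershipAtoms e ++ List.concatMap (translateAtom e) φ)
  translate e (∃≢p Y ψ) = ∃≢p (flatCtx Y) (translate (extendBlocks Y e) ψ)

  -- An atom R^{ij}_{st} relating entries of different sorts has no counterpart in H (no atom of H is
  -- unsatisfiable); formulas containing one define the empty relation and are treated separately.
  WellSortedAtom : ∀ {Γ} → Atom bH Γ → Set
  WellSortedAtom (rel (i , j , _ , s , t) _) = List.lookup (typ i) s ≡ List.lookup (typ j) t
  WellSortedAtom (eq _ _)                    = ⊤

  WellSorted : ∀ {Γ} → MppFormula bH Γ → Set
  WellSorted (qf φ)    = All WellSortedAtom φ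
  WellSorted (∃≢p Y ψ) = WellSorted ψ

  wellSortedAtom? : ∀ {Γ} (α : Atom bH Γ) → Dec (WellSortedAtom α)
  wellSortedAtom? (rel (i , j , _ , s , t) _) = List.lookup (typ i) s Fin.≟ List.lookup (typ j) t
  wellSortedAtom? (eq _ _)                    = yes tt

  wellSorted? : ∀ {Γ} (ψ : MppFormula bH Γ) → Dec (WellSorted ψ)
  wellSorted? (qf φ)    = All.all? wellSortedAtom? φ
  wellSorted? (∃≢p Y ψ) = wellSorted? ψ

  module _ (p : ℕ) where

    membershipAtoms-inRelations : ∀ {Γ Δ} (e : Blocks Γ Δ) ρ →
                                  eval H p (qf (membershipAtoms e)) ρ ≡ inRelations (decode e ρ)
    membershipAtoms-inRelations []              ρ = refl
    membershipAtoms-inRelations {j ∷ Γ} (c ∷ e) ρ =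
      cong (R j (All.map (All.lookup ρ) c) ∧_) (membershipAtoms-inRelations e ρ)

    sortedEqAtom-sameElem : ∀ {Δ i j} (u : i ∈ Δ) (v : j ∈ Δ) ρ → i ≡ j →
                            eval H p (qf (sortedEqAtom u v)) ρ ≡ sameElem decEq (All.lookup ρ u) (All.lookup ρ v)
    sortedEqAtom-sameElem u v ρ refl =
      trans (cong (λ φ → eval H p (qf φ) ρ) (sortedEqAtom-refl u v))
        (trans (∧-identityʳ _) (sym (sameElem-≡ decEq (All.lookup ρ u) (All.lookup ρ v))))
      where
      sortedEqAtom-refl : ∀ {Δ i} (u v : i ∈ Δ) → sortedEqAtom u v ≡ eq u v ∷ []
      sortedEqAtom-refl {i = i} u v with i Fin.≟ i
      ... | yes refl = refl
      ... | no i≢i   = ⊥-elim (i≢i refl)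

    eqAtoms-correct : ∀ {Δ Θ} (c d : All (_∈ Δ) Θ) ρ →
                      T (eval H p (qf (eqAtoms c d)) ρ) ⇔ (All.map (All.lookup ρ) c ≡ All.map (All.lookup ρ) d)
    eqAtoms-correct []      []      ρ = mk⇔ (λ _ → refl) (λ _ → tt)
    eqAtoms-correct (u ∷ c) (v ∷ d) ρ = mk⇔
      (λ t → let u≡v , c≡d = Equivalence.to T-∧ t
             in cong₂ _∷_ (toWitness u≡v) (Equivalence.to (eqAtoms-correct c d ρ) c≡d))
      (λ uc≡vd → let u≡v , c≡d = ∷-injective uc≡vd
                 in Equivalence.from T-∧ (fromWitness u≡v , Equivalence.from (eqAtoms-correct c d ρ) c≡d))

    decodes-lookup : ∀ {Γ Δ} (e : Blocks Γ Δ) ρ {σ} → Decodes e ρ σ → ∀ {j} (u : j ∈ Γ) →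
                     All.map (All.lookup ρ) (All.lookup e u) ≡ proj₁ (All.lookup σ u)
    decodes-lookup e ρ {σ} e↝σ u =
      trans (sym (lookup-map e u)) (trans (cong (λ w → All.lookup w u) e↝σ) (lookup-map σ u))

    decodes-at : ∀ {Γ Δ} (e : Blocks Γ Δ) ρ {σ} → Decodes e ρ σ → ∀ {j} (u : j ∈ Γ) s →
                 All.lookup ρ (Tuples.at (_∈ Δ) (All.lookup e u) s) ≡ at (proj₁ (All.lookup σ u)) s
    decodes-at e ρ e↝σ u s =
      trans (sym (at-map (All.lookup ρ) (All.lookup e u) s)) (cong (λ w → at w s) (decodes-lookup e ρ e↝σ u))

    translateAtom-sound : ∀ {Γ Δ} (e : Blocks Γ Δ) ρ σ (α : Atom bH Γ) → WellSortedAtom α → Decodes e ρ σ →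
                          eval H p (qf (translateAtom e α)) ρ ≡ evalAtom bH α σ
    translateAtom-sound e ρ σ (rel (_ , _ , _ , s , t) (u ∷ v ∷ [])) sorts≡ e↝σ =
      trans (sortedEqAtom-sameElem _ _ ρ sorts≡)
            (cong₂ (sameElem decEq) (decodes-at e ρ e↝σ u s) (decodes-at e ρ e↝σ v t))
    translateAtom-sound e ρ σ (eq u v) _ e↝σ = T⇔⇒≡ (mk⇔
      (λ t → fromWitness (Qdom-ext (trans (sym (decodes-lookup e ρ e↝σ u))
               (trans (Equivalence.to (eqAtoms-correct _ _ ρ) t) (decodes-lookup e ρ e↝σ v)))))
      (λ t → Equivalence.from (eqAtoms-correct _ _ ρ) (trans (decodes-lookup e ρ e↝σ u)
               (trans (cong proj₁ (toWitness t)) (sym (decodes-lookup e ρ e↝σ v))))))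

    translateAtoms-sound : ∀ {Γ Δ} (e : Blocks Γ Δ) ρ σ (φ : List (Atom bH Γ)) → All WellSortedAtom φ →
                           Decodes e ρ σ → eval H p (qf (List.concatMap (translateAtom e) φ)) ρ ≡ eval bH p (qf φ) σ
    translateAtoms-sound e ρ σ []      []        e↝σ = refl
    translateAtoms-sound e ρ σ (α ∷ φ) (wα ∷ wφ) e↝σ =
      trans (eval-qf-++ H p (translateAtom e α) (List.concatMap (translateAtom e) φ) ρ)
        (cong₂ _∧_ (translateAtom-sound e ρ σ α wα e↝σ) (translateAtoms-sound e ρ σ φ wφ e↝σ))

    inRelations-extend : ∀ {Γ Δ} Y (e : Blocks Γ Δ) ρ b →
                         T (inRelations (decode (extendBlocks Y e) (AllP.++⁺ ρ b))) →
                         T (inRelations (decode e ρ)) × T (inRelations (decode (canonicalBlocks Y) b))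
    inRelations-extend Y e ρ b =
      Equivalence.to T-∧ ∘ subst T (trans (cong inRelations (decode-extend Y e ρ b))
                                  (inRelations-++ (decode e ρ) (decode (canonicalBlocks Y) b)))

    translate-guarded : ∀ {Γ Δ} (e : Blocks Γ Δ) ψ ρ →
                        T (eval H p (translate e ψ) ρ) → T (inRelations (decode e ρ))
    translate-guarded e (qf φ) ρ t = subst T (membershipAtoms-inRelations e ρ)
      (proj₁ (Equivalence.to T-∧ (subst T (eval-qf-++ H p (membershipAtoms e) (List.concatMap (translateAtom e) φ) ρ) t)))
    translate-guarded e (∃≢p Y ψ) ρ t
      with ∤count⇒∃ p Pᴴ (enumAll enum (flatCtx Y))
             (subst (λ c → T (not ⌊ p ∣? c ⌋)) (countTrue≡count H Pᴴ (enumAll enum (flatCtx Y))) t)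
      where Pᴴ = λ b → eval H p (translate (extendBlocks Y e) ψ) (AllP.++⁺ ρ b)
    ... | b , Pᴴb = proj₁ (inRelations-extend Y e ρ b (translate-guarded (extendBlocks Y e) ψ (AllP.++⁺ ρ b) Pᴴb))

    flatten-onto : ∀ Y b → T (inRelations (decode (canonicalBlocks Y) b)) → ∃ λ (τ : All Q Y) → flatten τ ≡ b
    flatten-onto Y b b-in with inRelations⇒lift (decode (canonicalBlocks Y) b) b-in
    ... | τ , τ≡ = τ , trans (cong concatBlocks τ≡) (concat-decode-canonical Y b)

    translate-sound : ∀ {Γ Δ} (e : Blocks Γ Δ) ρ σ (ψ : MppFormula bH Γ) → WellSorted ψ → Decodes e ρ σ →
                      eval H p (translate e ψ) ρ ≡ eval bH p ψ σ
    translate-sound e ρ σ (qf φ) wφ e↝σ =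
      trans (eval-qf-++ H p (membershipAtoms e) (List.concatMap (translateAtom e) φ) ρ)
        (cong₂ _∧_ (trans (membershipAtoms-inRelations e ρ) (trans (cong inRelations e↝σ) (inRelations-proj₁ σ)))
                   (translateAtoms-sound e ρ σ φ wφ e↝σ))
    translate-sound e ρ σ (∃≢p Y ψ) wψ e↝σ = cong (λ c → not ⌊ p ∣? c ⌋) (begin
      countTrue H Pᴴ (enumAll enum (flatCtx Y))      ≡⟨ countTrue≡count H Pᴴ (enumAll enum (flatCtx Y)) ⟩
      count Pᴴ (enumAll enum (flatCtx Y))            ≡⟨ count-reindex flatten-injective Pᴴ
                                                          (enumAll-unique enum enum-unique _)
                                                          (enumAll-complete enum enum-complete _)
                                                          (Tuples.enumAll-unique Q enumᵇ (MS.enum-unique bH) Y)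
                                                          (Tuples.enumAll-complete Q enumᵇ (MS.enum-complete bH) Y) onto ⟩
      count (Pᴴ ∘ flatten) (Tuples.enumAll Q enumᵇ Y) ≡⟨ count-cong (λ τ → translate-sound (extendBlocks Y e) _ _ ψ wψ
                                                          (extend-decodes τ)) (Tuples.enumAll Q enumᵇ Y) ⟩
      count Pᵇ (Tuples.enumAll Q enumᵇ Y)           ≡⟨ sym (countTrue≡count bH Pᵇ (Tuples.enumAll Q enumᵇ Y)) ⟩
      countTrue bH Pᵇ (Tuples.enumAll Q enumᵇ Y)    ∎)
      where
      open ≡-Reasoning
      enumᵇ = MS.enum bH
      Pᴴ : All D (flatCtx Y) → Bool
      Pᴴ b = eval H p (translate (extendBlocks Y e) ψ) (AllP.++⁺ ρ b)
      Pᵇ : All Q Y → Bool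
      Pᵇ τ = eval bH p ψ (AllP.++⁺ σ τ)
      onto : ∀ b → T (Pᴴ b) → ∃ λ τ → flatten τ ≡ b
      onto b Pᴴb = flatten-onto Y b (proj₂ (inRelations-extend Y e ρ b (translate-guarded _ ψ _ Pᴴb)))
      extend-decodes : ∀ τ → Decodes (extendBlocks Y e) (AllP.++⁺ ρ (flatten τ)) (AllP.++⁺ σ τ)
      extend-decodes τ = begin
        decode (extendBlocks Y e) (AllP.++⁺ ρ (flatten τ))
          ≡⟨ decode-extend Y e ρ (flatten τ) ⟩
        AllP.++⁺ (decode e ρ) (decode (canonicalBlocks Y) (flatten τ))
          ≡⟨ cong₂ AllP.++⁺ e↝σ (decode-canonical (All.map proj₁ τ)) ⟩
        AllP.++⁺ (All.map proj₁ σ) (All.map proj₁ τ)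
          ≡⟨ sym (map-++⁺ proj₁ σ τ) ⟩
        All.map proj₁ (AllP.++⁺ σ τ) ∎

    illSorted-false : ∀ {Γ} (ψ : MppFormula bH Γ) σ → ¬ WellSorted ψ → eval bH p ψ σ ≡ false
    illSorted-false (qf φ) σ ill = atoms-false φ ill
      where
      atom-false : ∀ α → ¬ WellSortedAtom α → evalAtom bH α σ ≡ false
      atom-false (rel (_ , _ , _ , s , t) (u ∷ v ∷ [])) ill-α = ¬T⇒≡false (ill-α ∘ Same-sort ∘
        sameElem⇒Same (at (proj₁ (All.lookup σ u)) s) (at (proj₁ (All.lookup σ v)) t))
      atom-false (eq _ _) ill-α = ⊥-elim (ill-α tt)
      atoms-false : ∀ φ → ¬ All WellSortedAtom φ → eval bH p (qf φ) σ ≡ false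
      atoms-false []      ill-φ = ⊥-elim (ill-φ [])
      atoms-false (α ∷ φ) ill-φ with wellSortedAtom? α
      ... | yes wα   = trans (cong (evalAtom bH α σ ∧_) (atoms-false φ (ill-φ ∘ (wα ∷_)))) (∧-zeroʳ _)
      ... | no ill-α = cong (_∧ eval bH p (qf φ) σ) (atom-false α ill-α)
    illSorted-false (∃≢p Y ψ) σ ill = trans (cong (λ c → not ⌊ p ∣? c ⌋) (begin
      countTrue bH Pᵇ τs        ≡⟨ countTrue≡count bH Pᵇ τs ⟩
      count Pᵇ τs               ≡⟨ count-cong (λ τ → illSorted-false ψ (AllP.++⁺ σ τ) ill) τs ⟩
      count (λ _ → false) τs    ≡⟨ count-false τs ⟩
      0                         ∎)) (not-∣?0 p)
      where
      open ≡-Reasoning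
      τs = Tuples.enumAll Q (MS.enum bH) Y
      Pᵇ : All Q Y → Bool
      Pᵇ τ = eval bH p ψ (AllP.++⁺ σ τ)

  blockSubset : ∀ (Θ : List (Fin k)) {Ξ : List (Fin k)} → Bool → Subset (length Ξ) → Subset (length (Θ ++ Ξ))
  blockSubset []      b J = J
  blockSubset (_ ∷ Θ) b J = b ∷ blockSubset Θ b J

  flatSubset : ∀ Γ → Subset (length Γ) → Subset (length (flatCtx Γ))
  flatSubset []      []      = []
  flatSubset (j ∷ Γ) (b ∷ I) = blockSubset (typ j) {flatCtx Γ} b (flatSubset Γ I)

  ∁-blockSubset : ∀ (Θ : List (Fin k)) {Ξ} b (J : Subset (length Ξ)) →
                  ∁ (blockSubset Θ {Ξ} b J) ≡ blockSubset Θ {Ξ} (not b) (∁ J)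
  ∁-blockSubset []      b J = refl
  ∁-blockSubset (_ ∷ Θ) b J = cong (not b ∷_) (∁-blockSubset Θ b J)

  ∁-flatSubset : ∀ Γ I → ∁ (flatSubset Γ I) ≡ flatSubset Γ (∁ I)
  ∁-flatSubset []      []      = refl
  ∁-flatSubset (j ∷ Γ) (b ∷ I) =
    trans (∁-blockSubset (typ j) {flatCtx Γ} b (flatSubset Γ I))
          (cong (blockSubset (typ j) {flatCtx Γ} (not b)) (∁-flatSubset Γ I))

  agreeOn-++ : ∀ (Θ : List (Fin k)) {Ξ} b J (a a′ : All D Θ) (c c′ : All D Ξ) →
               (b ≡ true → a ≡ a′) → AgreeOn H J c c′ →
               AgreeOn H {Θ ++ Ξ} (blockSubset Θ {Ξ} b J) (AllP.++⁺ a c) (AllP.++⁺ a′ c′)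
  agreeOn-++ []      b J []      []        c c′ a≡a′ c~c′ = c~c′
  agreeOn-++ (_ ∷ Θ) b J (u ∷ a) (u′ ∷ a′) c c′ a≡a′ c~c′ zero    here       =
    proj₁ (∷-injective (a≡a′ refl))
  agreeOn-++ (_ ∷ Θ) b J (u ∷ a) (u′ ∷ a′) c c′ a≡a′ c~c′ (suc s) (there s∈) =
    agreeOn-++ Θ b J a a′ c c′ (proj₂ ∘ ∷-injective ∘ a≡a′) c~c′ s s∈

  agreeOn-flatten : ∀ Γ I (x y : All Q Γ) → AgreeOn bH I x y →
                    AgreeOn H {flatCtx Γ} (flatSubset Γ I) (flatten x) (flatten y)
  agreeOn-flatten []      []      []      []      _       = λ ()
  agreeOn-flatten (j ∷ Γ) (b ∷ I) (q ∷ x) (r ∷ y) qx~ry =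
    agreeOn-++ (typ j) {flatCtx Γ} b (flatSubset Γ I) (proj₁ q) (proj₁ r) (flatten x) (flatten y)
      (λ { refl → cong proj₁ (qx~ry zero here) }) (agreeOn-flatten Γ I x y λ s s∈ → qx~ry (suc s) (there s∈))

  agreeOn-∁-flatten : ∀ Γ I (x y : All Q Γ) → AgreeOn bH (∁ I) x y →
                      AgreeOn H {flatCtx Γ} (∁ (flatSubset Γ I)) (flatten x) (flatten y)
  agreeOn-∁-flatten Γ I x y =
    subst (λ J → AgreeOn H {flatCtx Γ} J (flatten x) (flatten y)) (sym (∁-flatSubset Γ I))
    ∘ agreeOn-flatten Γ (∁ I) x y

  -- The flattened partition has an empty side when all coordinates on that side of I have sorts Q_j of
  -- arity 0; then w equals y or z.
  rectangular-flatten : ∀ {Γ} (S : All Q Γ → Bool) (S♭ : All D (flatCtx Γ) → Bool) →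
                        (∀ a → S♭ (flatten a) ≡ S a) →
                        (2 ≤ length (flatCtx Γ) → Rectangular H S♭) → Rectangular bH S
  rectangular-flatten {Γ} S S♭ S♭≗S S♭-rect I _ _ x y z w Sx Sy Sz x~y x~∁z w~z w~∁y
    with nonempty? (flatSubset Γ I) | nonempty? (∁ (flatSubset Γ I))
  ... | yes I♭≠∅ | yes ∁I♭≠∅ = subst T (S♭≗S w)
    (S♭-rect (Nonempty-∁⇒2≤ I♭ I♭≠∅ ∁I♭≠∅) I♭ I♭≠∅ ∁I♭≠∅ (flatten x) (flatten y) (flatten z) (flatten w)
      (S♭-flatten x Sx) (S♭-flatten y Sy) (S♭-flatten z Sz)
      (agreeOn-flatten Γ I x y x~y) (agreeOn-∁-flatten Γ I x z x~∁z)
      (agreeOn-flatten Γ I w z w~z) (agreeOn-∁-flatten Γ I w y w~∁y))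
    where
    I♭ = flatSubset Γ I
    S♭-flatten : ∀ a → T (S a) → T (S♭ (flatten a))
    S♭-flatten a = subst T (sym (S♭≗S a))
  ... | no I♭≡∅ | _ = subst (T ∘ S) (sym (flatten-injective
    (AgreeOn-∁⇒≡ H {flatCtx Γ} (flatSubset Γ I) {flatten w} {flatten y}
      (AgreeOn-empty H {flatCtx Γ} (flatSubset Γ I) {flatten w} {flatten y} I♭≡∅)
      (agreeOn-∁-flatten Γ I w y w~∁y)))) Sy
  ... | yes _ | no ∁I♭≡∅ = subst (T ∘ S) (sym (flatten-injective
    (AgreeOn-∁⇒≡ H {flatCtx Γ} (flatSubset Γ I) {flatten w} {flatten z} (agreeOn-flatten Γ I w z w~z)
      (AgreeOn-empty H {flatCtx Γ} (∁ (flatSubset Γ I)) {flatten w} {flatten z} ∁I♭≡∅)))) Sz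

  stronglyRectangular⇒binarize : ∀ p → StronglyRectangular H p → StronglyRectangular bH p
  stronglyRectangular⇒binarize p H-rect Δ S _ (ψ , ψ≗S) with wellSorted? ψ
  ... | no ill = empty⇒rectangular bH S λ a Sa → subst T (trans (sym (ψ≗S a)) (illSorted-false p ψ a ill)) Sa
  ... | yes ws = rectangular-flatten S (eval H p ψ♭) (λ a →
    trans (translate-sound p (canonicalBlocks Δ) (flatten a) a ψ ws (decode-canonical (All.map proj₁ a))) (ψ≗S a))
    (λ 2≤ → H-rect (flatCtx Δ) (eval H p ψ♭) 2≤ (ψ♭ , λ _ → refl))
    where ψ♭ = translate (canonicalBlocks Δ) ψ

proposition9p2 : ∀ {n : ℕ} (H : MS (Fin n)) → DomainsAreRelations H →
                   (p : ℕ) → Prime p →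
                   (HasMaltsev H ⇔ HasMaltsev (binarize H)) ×
                   (PRigid H p ⇔ PRigid (binarize H) p) ×
                   (StronglyRectangular H p → StronglyRectangular (binarize H) p)
proposition9p2 H domains p p-prime =
  maltsev⇔binarize-maltsev domains , rigid⇔binarize-rigid domains p p-prime , stronglyRectangular⇒binarize p
  where open Binarization H
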